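{- Let $E$ be a finite set, $r:2^E\to\mathbb{Z}$ any function, $R$ a commutative ring with $1$, and $m_1,m_2:2^E\to R$ two functions; let $m_1m_2$ denote their pointwise product. Let $t,s$ and $u_e,v_e$ ($e\in E$) be indeterminates. Then, in $R[t^{\pm1},s^{\pm1},u_e,v_e : e\in E]$, $$\mathbf{Z}_{(E,r,m_1m_2)}\bigl(ts,\ (u_ev_e)_{e\in E}\bigr)=\sum_{A\subseteq E} s^{ -r(A)}\Bigl(\prod_{e\in A}(-v_e)\Bigr)\,\mathbf{Z}_{(E,r,m_1)|A}\bigl(t,(-u_e)_{e\in A}\bigr)\,\mathbf{Z}_{(E,r,m_2)/A}\bigl(s,(v_e)_{e\in E\setminus A}\bigr).$$
   Context: A ranked set with multiplicity (rsm) is a triple $\mathcal{M}=(E,r,m)$ with $E$ a finite set, $r:2^E\to\mathbb{Z}$ an arbitrary function ($r(\emptyset)$ may be nonzero) and $m:2^E\to R$ an arbitrary function. Its multivariate Tutte polynomial is $\mathbf{Z}_{\mathcal{M}}(q,(v_e)_{e\in E})=\sum_{A\subseteq E} m(A)\,q^{ -r(A)}\prod_{e\in A}v_e$ (empty product $=1$). For $A\subseteq E$, the restriction $\mathcal{M}|A$ is the rsm $(A, r|_{2^A}, m|_{2^A})$, and the contraction $\mathcal{M}/A$ is the rsm $(E\setminus A, r', m')$ with $r'(B)=r(B\cup A)-r(A)$ and $m'(B)=m(B\cup A)$ for $B\subseteq E\setminus A$. -}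

module Defs where

open import Level using (Level)
open import Data.Nat using (ℕ; zero; suc)
open import Data.Integer as ℤ using (ℤ; +_; -[1+_])
open import Data.Fin using (Fin)
import Data.Fin as Fin
open import Data.Fin.Subset using (Subset; outside; inside)
open import Data.Vec using (_∷_; [])
open import Data.List using (List; []; _∷_; _++_; map)
open import Algebra.Bundles using (CommutativeRing)

subsetsOf : ∀ {n} → Subset n → List (Subset n)
subsetsOf {zero} [] = [] ∷ []
subsetsOf {suc n} (outside ∷ G) = map (outside ∷_) (subsetsOf G)
subsetsOf {suc n} (inside ∷ G) =
  map (outside ∷_) (subsetsOf G) ++ map (inside ∷_) (subsetsOf G)

module Tutte {c ℓ : Level} (R : CommutativeRing c ℓ) where
  open CommutativeRing R

  sumList : List Carrier → Carrier
  sumList [] = 0#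
  sumList (x ∷ xs) = x + sumList xs

  prodOver : ∀ {n} → Subset n → (Fin n → Carrier) → Carrier
  prodOver [] f = 1#
  prodOver (outside ∷ A) f = prodOver A (λ i → f (Fin.suc i))
  prodOver (inside ∷ A) f = f Fin.zero * prodOver A (λ i → f (Fin.suc i))

  pow : Carrier → ℕ → Carrier
  pow x zero = 1#
  pow x (suc k) = x * pow x k

  -- integer power q^k of a unit q with given inverse qi
  zpow : Carrier → Carrier → ℤ → Carrier
  zpow q qi (+ k) = pow q k
  zpow q qi (-[1+ k ]) = pow qi (suc k)

  -- Multivariate Tutte polynomial of the rsm (G, r|, m|) with G ⊆ Fin n,
  -- evaluated at q (inverse qi) and (v_e):
  --   Σ_{B ⊆ G} m(B) q^{-r(B)} ∏_{e∈B} v_e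
  Z : ∀ {n} → Subset n → (Subset n → ℤ) → (Subset n → Carrier) →
      Carrier → Carrier → (Fin n → Carrier) → Carrier
  Z G r m q qi v =
    sumList (map (λ B → m B * (zpow q qi (ℤ.- r B) * prodOver B v)) (subsetsOf G))

module Submission where

-- Expanding both Tutte polynomials on the right-hand side turns the
-- summand for A into a double sum over B ⊆ A and C ⊆ E ∖ A of
--   ∏_A (-v) · ∏_B (-u) · ∏_C v · F(B, C ∪ A),
-- where F(B, D) = m₁(B) t^{-r(B)} · m₂(D) s^{-r(D)}; the factor s^{-r(A)}
-- is absorbed because s^{-r(A)} s^{-(r(D)-r(A))} = s^{-r(D)}.  The whole
-- right-hand side is thus a "chain sum" over triples (A, B, C).  The
-- combinatorial heart of the proof is the collapse lemma: whenever
-- a_e + c_e = 0 for every e, the chain sum with weights a, b, c equals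
-- Σ_D ∏_D (a b) · F(D, D), since for each coordinate the two
-- configurations "e ∈ C" and "e ∈ A ∖ B" cancel (inclusion–exclusion).
-- With a = -v, b = -u, c = v this is exactly the left-hand side.

open import Defs
open import Level using (Level)
open import Data.Nat as ℕ using (ℕ; zero; suc)
open import Data.Integer as ℤ using (ℤ; +_; -[1+_])
import Data.Integer.Properties as ℤP
open import Data.Integer.Solver using (module +-*-Solver)
open import Data.Fin using (Fin)
import Data.Fin as Fin
open import Data.Fin.Subset using (Subset; ⊤; _∪_; _─_; inside; outside)
open import Data.Vec using ([]; _∷_)
open import Data.List as List using (List; map; _++_)
open import Data.List.Properties using (map-∘; map-++)
open import Data.Product using (∃₂; _,_)
open import Algebra.Bundles using (CommutativeRing)
import Relation.Binary.PropositionalEquality as ≡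
import Algebra.Properties.Ring as RingProperties
import Algebra.Properties.CommutativeSemiring.Exp as Exp

⊖-+ : ∀ p q p′ q′ → (p ℤ.⊖ q) ℤ.+ (p′ ℤ.⊖ q′) ≡.≡ (p ℕ.+ p′) ℤ.⊖ (q ℕ.+ q′)
⊖-+ p q p′ q′ = begin
  (p ℤ.⊖ q) ℤ.+ (p′ ℤ.⊖ q′)
    ≡⟨ ≡.cong₂ ℤ._+_ (≡.sym (ℤP.[+m]-[+n]≡m⊖n p q)) (≡.sym (ℤP.[+m]-[+n]≡m⊖n p′ q′)) ⟩
  (+ p ℤ.- + q) ℤ.+ (+ p′ ℤ.- + q′)
    ≡⟨ solve 4 (λ a b c d → (a :- b) :+ (c :- d) := (a :+ c) :- (b :+ d))
         ≡.refl (+ p) (+ q) (+ p′) (+ q′) ⟩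
  (+ p ℤ.+ + p′) ℤ.- (+ q ℤ.+ + q′)
    ≡⟨ ≡.cong₂ ℤ._-_ (≡.sym (ℤP.pos-+ p p′)) (≡.sym (ℤP.pos-+ q q′)) ⟩
  + (p ℕ.+ p′) ℤ.- + (q ℕ.+ q′)
    ≡⟨ ℤP.[+m]-[+n]≡m⊖n (p ℕ.+ p′) (q ℕ.+ q′) ⟩
  (p ℕ.+ p′) ℤ.⊖ (q ℕ.+ q′) ∎
  where open ≡.≡-Reasoning
        open +-*-Solver

⊖-surjective : ∀ x → ∃₂ λ p q → x ≡.≡ p ℤ.⊖ q
⊖-surjective (+ p) = p , 0 , ≡.sym (ℤP.⊖-≥ {p} {0} ℕ.z≤n)
⊖-surjective (-[1+ q ]) = 0 , suc q , ≡.sym (ℤP.⊖-< {0} {suc q} ℕ.z<s)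

-- The exponent identity behind s^{-r(A)} · s^{-(r(D) - r(A))} = s^{-r(D)}.
neg-split : ∀ a d → ℤ.- a ℤ.+ ℤ.- (d ℤ.- a) ≡.≡ ℤ.- d
neg-split = solve 2 (λ a d → (:- a) :+ (:- (d :- a)) := :- d) ≡.refl
  where open +-*-Solver

module Proof {c ℓ : Level} (R : CommutativeRing c ℓ) where
  open CommutativeRing R
  open Tutte R
  open import Relation.Binary.Reasoning.Setoid setoid
  open import Algebra.Solver.Ring.NaturalCoefficients.Default commutativeSemiring
  open RingProperties ring using (-‿distribˡ-*; -‿distribʳ-*; -‿involutive)
  open Exp commutativeSemiring using (_^_; ^-homo-*; ^-distrib-*)

  -- Subset sums Σ_{B ⊆ G} f B, defined by recursion on the coordinates so
  -- that sums over x ∷ G unfold definitionally.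
  sumSub : ∀ {n} → Subset n → (Subset n → Carrier) → Carrier
  sumSub {zero} [] f = f []
  sumSub (outside ∷ G) f = sumSub G (λ B → f (outside ∷ B))
  sumSub (inside ∷ G) f = sumSub G (λ B → f (outside ∷ B)) + sumSub G (λ B → f (inside ∷ B))

  sumList-++ : ∀ xs ys → sumList (xs ++ ys) ≈ sumList xs + sumList ys
  sumList-++ List.[] ys = sym (+-identityˡ _)
  sumList-++ (x List.∷ xs) ys = trans (+-congˡ (sumList-++ xs ys)) (sym (+-assoc _ _ _))

  sumList≈sumSub : ∀ {n} (G : Subset n) f → sumList (map f (subsetsOf G)) ≈ sumSub G f
  sumList≈sumSub [] f = +-identityʳ _
  sumList≈sumSub (outside ∷ G) f =
    trans (reflexive (≡.cong sumList (≡.sym (map-∘ (subsetsOf G))))) (sumList≈sumSub G _)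
  sumList≈sumSub (inside ∷ G) f = begin
    sumList (map f (map (outside ∷_) S ++ map (inside ∷_) S))
      ≡⟨ ≡.cong sumList (map-++ f (map (outside ∷_) S) (map (inside ∷_) S)) ⟩
    sumList (map f (map (outside ∷_) S) ++ map f (map (inside ∷_) S))
      ≈⟨ sumList-++ (map f (map (outside ∷_) S)) (map f (map (inside ∷_) S)) ⟩
    sumList (map f (map (outside ∷_) S)) + sumList (map f (map (inside ∷_) S))
      ≡⟨ ≡.cong₂ (λ x y → sumList x + sumList y) (≡.sym (map-∘ S)) (≡.sym (map-∘ S)) ⟩
    sumList (map (λ B → f (outside ∷ B)) S) + sumList (map (λ B → f (inside ∷ B)) S)
      ≈⟨ +-cong (sumList≈sumSub G _) (sumList≈sumSub G _) ⟩
    sumSub (inside ∷ G) f ∎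
    where S = subsetsOf G

  sumSub-cong : ∀ {n} (G : Subset n) {f g : Subset n → Carrier} →
                (∀ B → f B ≈ g B) → sumSub G f ≈ sumSub G g
  sumSub-cong [] eq = eq []
  sumSub-cong (outside ∷ G) eq = sumSub-cong G (λ B → eq _)
  sumSub-cong (inside ∷ G) eq = +-cong (sumSub-cong G (λ B → eq _)) (sumSub-cong G (λ B → eq _))

  sumSub-+ : ∀ {n} (G : Subset n) f g → sumSub G f + sumSub G g ≈ sumSub G (λ B → f B + g B)
  sumSub-+ [] f g = refl
  sumSub-+ (outside ∷ G) f g = sumSub-+ G _ _
  sumSub-+ (inside ∷ G) f g = trans (swap _ _ _ _) (+-cong (sumSub-+ G _ _) (sumSub-+ G _ _))
    where
    swap : ∀ a b c d → (a + b) + (c + d) ≈ (a + c) + (b + d)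
    swap = solve 4 (λ a b c d → (a :+ b) :+ (c :+ d) := (a :+ c) :+ (b :+ d)) refl

  sumSub-*ˡ : ∀ {n} (G : Subset n) k f → k * sumSub G f ≈ sumSub G (λ B → k * f B)
  sumSub-*ˡ [] k f = refl
  sumSub-*ˡ (outside ∷ G) k f = sumSub-*ˡ G k _
  sumSub-*ˡ (inside ∷ G) k f = trans (distribˡ k _ _) (+-cong (sumSub-*ˡ G k _) (sumSub-*ˡ G k _))

  sumSub² : ∀ {n} → Subset n → Subset n → (Subset n → Subset n → Carrier) → Carrier
  sumSub² G H f = sumSub G (λ B → sumSub H (f B))

  sumSub²-+ : ∀ {n} (G H : Subset n) f g →
              sumSub² G H f + sumSub² G H g ≈ sumSub² G H (λ B C → f B C + g B C)
  sumSub²-+ G H f g = trans (sumSub-+ G _ _) (sumSub-cong G (λ B → sumSub-+ H (f B) (g B)))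

  sumSub²-*ˡ : ∀ {n} (G H : Subset n) k f → k * sumSub² G H f ≈ sumSub² G H (λ B C → k * f B C)
  sumSub²-*ˡ G H k f = trans (sumSub-*ˡ G k _) (sumSub-cong G (λ B → sumSub-*ˡ H k (f B)))

  sumSub-*-sumSub : ∀ {n} (G H : Subset n) f g →
                    sumSub G f * sumSub H g ≈ sumSub² G H (λ B C → f B * g C)
  sumSub-*-sumSub G H f g = begin
    sumSub G f * sumSub H g              ≈⟨ *-comm _ _ ⟩
    sumSub H g * sumSub G f              ≈⟨ sumSub-*ˡ G _ f ⟩
    sumSub G (λ B → sumSub H g * f B)    ≈⟨ sumSub-cong G (λ B → *-comm _ (f B)) ⟩
    sumSub G (λ B → f B * sumSub H g)    ≈⟨ sumSub-cong G (λ B → sumSub-*ˡ H (f B) g) ⟩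
    sumSub² G H (λ B C → f B * g C)      ∎

  prodOver-cong : ∀ {n} (A : Subset n) {f g : Fin n → Carrier} →
                  (∀ e → f e ≈ g e) → prodOver A f ≈ prodOver A g
  prodOver-cong [] eq = refl
  prodOver-cong (outside ∷ A) eq = prodOver-cong A (λ e → eq _)
  prodOver-cong (inside ∷ A) eq = *-cong (eq _) (prodOver-cong A (λ e → eq _))

  neg-*-neg : ∀ x y → - x * - y ≈ y * x
  neg-*-neg x y = begin
    - x * - y        ≈⟨ -‿distribˡ-* x (- y) ⟨
    - (x * - y)      ≈⟨ -‿cong (-‿distribʳ-* x y) ⟨
    - (- (x * y))    ≈⟨ -‿involutive _ ⟩
    x * y            ≈⟨ *-comm x y ⟩
    y * x            ∎

  pow≡^ : ∀ x k → pow x k ≡.≡ x ^ k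
  pow≡^ x zero = ≡.refl
  pow≡^ x (suc k) = ≡.cong (x *_) (pow≡^ x k)

  pow-+ : ∀ x p q → pow x (p ℕ.+ q) ≈ pow x p * pow x q
  pow-+ x p q rewrite pow≡^ x (p ℕ.+ q) | pow≡^ x p | pow≡^ x q = ^-homo-* x p q

  pow-* : ∀ x y k → pow (x * y) k ≈ pow x k * pow y k
  pow-* x y k rewrite pow≡^ (x * y) k | pow≡^ x k | pow≡^ y k = ^-distrib-* x y k

  zpow-* : ∀ t ti s si k → zpow (t * s) (ti * si) k ≈ zpow t ti k * zpow s si k
  zpow-* t ti s si (+ k) = pow-* t s k
  zpow-* t ti s si (-[1+ k ]) = pow-* ti si (suc k)

  module _ (s si : Carrier) (inv : s * si ≈ 1#) where
    zpow-⊖ : ∀ p q → zpow s si (p ℤ.⊖ q) ≈ pow s p * pow si q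
    zpow-⊖ p zero =
      trans (reflexive (≡.cong (zpow s si) (ℤP.⊖-≥ {p} {0} ℕ.z≤n))) (sym (*-identityʳ _))
    zpow-⊖ zero (suc q) =
      trans (reflexive (≡.cong (zpow s si) (ℤP.⊖-< {0} {suc q} ℕ.z<s))) (sym (*-identityˡ _))
    zpow-⊖ (suc p) (suc q) = begin
      zpow s si (suc p ℤ.⊖ suc q)        ≡⟨ ≡.cong (zpow s si) (ℤP.[1+m]⊖[1+n]≡m⊖n p q) ⟩
      zpow s si (p ℤ.⊖ q)                ≈⟨ zpow-⊖ p q ⟩
      pow s p * pow si q                 ≈⟨ *-identityˡ _ ⟨
      1# * (pow s p * pow si q)          ≈⟨ *-congʳ inv ⟨
      (s * si) * (pow s p * pow si q)
        ≈⟨ solve 4 (λ s si a b → (s :* si) :* (a :* b) := (s :* a) :* (si :* b)) refl s si _ _ ⟩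
      (s * pow s p) * (si * pow si q)    ∎

    zpow-+ : ∀ x y → zpow s si (x ℤ.+ y) ≈ zpow s si x * zpow s si y
    zpow-+ x y with ⊖-surjective x | ⊖-surjective y
    ... | p , q , ≡.refl | p′ , q′ , ≡.refl = begin
      zpow s si ((p ℤ.⊖ q) ℤ.+ (p′ ℤ.⊖ q′))      ≡⟨ ≡.cong (zpow s si) (⊖-+ p q p′ q′) ⟩
      zpow s si ((p ℕ.+ p′) ℤ.⊖ (q ℕ.+ q′))      ≈⟨ zpow-⊖ (p ℕ.+ p′) (q ℕ.+ q′) ⟩
      pow s (p ℕ.+ p′) * pow si (q ℕ.+ q′)       ≈⟨ *-cong (pow-+ s p p′) (pow-+ si q q′) ⟩
      (pow s p * pow s p′) * (pow si q * pow si q′)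
        ≈⟨ solve 4 (λ a b c d → (a :* b) :* (c :* d) := (a :* c) :* (b :* d)) refl _ _ _ _ ⟩
      (pow s p * pow si q) * (pow s p′ * pow si q′) ≈⟨ *-cong (zpow-⊖ p q) (zpow-⊖ p′ q′) ⟨
      zpow s si (p ℤ.⊖ q) * zpow s si (p′ ℤ.⊖ q′) ∎

    zpow-split : ∀ a d → zpow s si (ℤ.- a) * zpow s si (ℤ.- (d ℤ.- a)) ≈ zpow s si (ℤ.- d)
    zpow-split a d =
      trans (sym (zpow-+ (ℤ.- a) (ℤ.- (d ℤ.- a)))) (reflexive (≡.cong (zpow s si) (neg-split a d)))

  Chain : ∀ {n} → (Subset n → Subset n → Subset n → Carrier) → Carrier
  Chain w = sumSub ⊤ (λ A → sumSub² A (⊤ ─ A) (w A))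

  Chain-cong : ∀ {n} {w w′ : Subset n → Subset n → Subset n → Carrier} →
               (∀ A B C → w A B C ≈ w′ A B C) → Chain w ≈ Chain w′
  Chain-cong eq = sumSub-cong ⊤ (λ A → sumSub-cong A (λ B → sumSub-cong (⊤ ─ A) (eq A B)))

  -- Splitting off the first coordinate: since B ⊆ A and C ∩ A = ∅, it lies
  -- in none of A, B, C, in C only, in A only, or in A and B.
  Chain-step : ∀ {n} (w : Subset (suc n) → Subset (suc n) → Subset (suc n) → Carrier) →
    Chain w ≈ Chain (λ A B C →
      (w (outside ∷ A) (outside ∷ B) (outside ∷ C) + w (outside ∷ A) (outside ∷ B) (inside ∷ C))
      + (w (inside ∷ A) (outside ∷ B) (outside ∷ C) + w (inside ∷ A) (inside ∷ B) (outside ∷ C)))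
  Chain-step {n} w =
    trans (+-cong (sumSub-cong (⊤ {n}) (λ A → sumSub-cong A (λ B → sumSub-+ (⊤ ─ A) _ _)))
                  (sumSub-cong (⊤ {n}) (λ A → sumSub²-+ A (⊤ ─ A) _ _)))
   (trans (sumSub-+ (⊤ {n}) _ _)
          (sumSub-cong (⊤ {n}) (λ A → sumSub²-+ A (⊤ ─ A) _ _)))

  -- One coordinate of the collapse: with a₀ + c₀ = 0 the configurations
  -- "in C only" and "in A only" cancel, leaving "none" and "in A and B".
  coordinate-cancel : ∀ a₀ b₀ c₀ pa pb pc Foo Foi Fii → a₀ + c₀ ≈ 0# →
    (pa * (pb * (pc * Foo)) + pa * (pb * ((c₀ * pc) * Foi)))
    + ((a₀ * pa) * (pb * (pc * Foi)) + (a₀ * pa) * ((b₀ * pb) * (pc * Fii)))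
    ≈ pa * (pb * (pc * (Foo + (a₀ * b₀) * Fii)))
  coordinate-cancel a₀ b₀ c₀ pa pb pc Foo Foi Fii cancel = begin
    (pa * (pb * (pc * Foo)) + pa * (pb * ((c₀ * pc) * Foi)))
    + ((a₀ * pa) * (pb * (pc * Foi)) + (a₀ * pa) * ((b₀ * pb) * (pc * Fii)))
      ≈⟨ solve 9 (λ a₀ b₀ c₀ pa pb pc Foo Foi Fii →
           (pa :* (pb :* (pc :* Foo)) :+ pa :* (pb :* ((c₀ :* pc) :* Foi)))
           :+ ((a₀ :* pa) :* (pb :* (pc :* Foi)) :+ (a₀ :* pa) :* ((b₀ :* pb) :* (pc :* Fii)))
           := pa :* (pb :* (pc :* (Foo :+ (a₀ :* b₀) :* Fii))) :+ (a₀ :+ c₀) :* (pa :* (pb :* (pc :* Foi))))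
           refl a₀ b₀ c₀ pa pb pc Foo Foi Fii ⟩
    pa * (pb * (pc * (Foo + (a₀ * b₀) * Fii))) + (a₀ + c₀) * (pa * (pb * (pc * Foi)))
      ≈⟨ +-congˡ (trans (*-congʳ cancel) (zeroˡ _)) ⟩
    pa * (pb * (pc * (Foo + (a₀ * b₀) * Fii))) + 0#
      ≈⟨ +-identityʳ _ ⟩
    pa * (pb * (pc * (Foo + (a₀ * b₀) * Fii))) ∎

  chainWeight : ∀ {n} (a b c : Fin n → Carrier) (F : Subset n → Subset n → Carrier) →
                Subset n → Subset n → Subset n → Carrier
  chainWeight a b c F A B C = prodOver A a * (prodOver B b * (prodOver C c * F B (C ∪ A)))

  collapse : ∀ {n} (a b c : Fin n → Carrier) → (∀ e → a e + c e ≈ 0#) →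
             (F : Subset n → Subset n → Carrier) →
             Chain (chainWeight a b c F) ≈ sumSub ⊤ (λ D → prodOver D (λ e → a e * b e) * F D D)
  collapse {zero} a b c cancel F = trans (*-identityˡ _) (*-identityˡ _)
  collapse {suc n} a b c cancel F = begin
    Chain (chainWeight a b c F)
      ≈⟨ Chain-step (chainWeight a b c F) ⟩
    _ -- the four first-coordinate configurations, summed inside one chain
      ≈⟨ Chain-cong (λ A B C → coordinate-cancel a₀ b₀ c₀ (prodOver A a′) (prodOver B b′) (prodOver C c′)
           (F (outside ∷ B) (outside ∷ (C ∪ A))) (F (outside ∷ B) (inside ∷ (C ∪ A)))
           (F (inside ∷ B) (inside ∷ (C ∪ A))) (cancel Fin.zero)) ⟩
    Chain (chainWeight a′ b′ c′ F′)
      ≈⟨ collapse a′ b′ c′ (λ e → cancel (Fin.suc e)) F′ ⟩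
    sumSub ⊤ (λ D → ab D * F′ D D)
      ≈⟨ sumSub-cong (⊤ {n}) (λ D → distribˡ (ab D) _ _) ⟩
    sumSub ⊤ (λ D → ab D * F (outside ∷ D) (outside ∷ D) + ab D * ((a₀ * b₀) * F (inside ∷ D) (inside ∷ D)))
      ≈⟨ sumSub-cong (⊤ {n}) (λ D → +-congˡ (sym (*-assoc _ _ _))) ⟩
    sumSub ⊤ (λ D → ab D * F (outside ∷ D) (outside ∷ D) + (ab D * (a₀ * b₀)) * F (inside ∷ D) (inside ∷ D))
      ≈⟨ sumSub-cong (⊤ {n}) (λ D → +-congˡ (*-congʳ (*-comm _ _))) ⟩
    sumSub ⊤ (λ D → ab D * F (outside ∷ D) (outside ∷ D) + ((a₀ * b₀) * ab D) * F (inside ∷ D) (inside ∷ D))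
      ≈⟨ sumSub-+ (⊤ {n}) _ _ ⟨
    sumSub ⊤ (λ D → prodOver D (λ e → a e * b e) * F D D) ∎
    where
    a₀ b₀ c₀ : Carrier
    a₀ = a Fin.zero
    b₀ = b Fin.zero
    c₀ = c Fin.zero
    a′ b′ c′ : Fin n → Carrier
    a′ e = a (Fin.suc e)
    b′ e = b (Fin.suc e)
    c′ e = c (Fin.suc e)
    ab : Subset n → Carrier
    ab D = prodOver D (λ e → a′ e * b′ e)
    -- the surviving first-coordinate configurations, folded into F
    F′ : Subset n → Subset n → Carrier
    F′ B D = F (outside ∷ B) (outside ∷ D) + (a₀ * b₀) * F (inside ∷ B) (inside ∷ D)

  module Expansion (n : ℕ) (r : Subset n → ℤ) (m₁ m₂ : Subset n → Carrier)
                   (t ti s si : Carrier) where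

    F : Subset n → Subset n → Carrier
    F B D = (m₁ B * zpow t ti (ℤ.- r B)) * (m₂ D * zpow s si (ℤ.- r D))

    lhs-collapsed : (u v : Fin n → Carrier) → Z ⊤ r (λ A → m₁ A * m₂ A) (t * s) (ti * si) (λ e → u e * v e)
                    ≈ sumSub ⊤ (λ D → prodOver D (λ e → - v e * - u e) * F D D)
    lhs-collapsed u v = trans (sumList≈sumSub (⊤ {n}) _) (sumSub-cong ⊤ summand)
      where
      summand : ∀ D → (m₁ D * m₂ D) * (zpow (t * s) (ti * si) (ℤ.- r D) * prodOver D (λ e → u e * v e))
                      ≈ prodOver D (λ e → - v e * - u e) * F D D
      summand D =
        trans (*-congˡ (*-cong (zpow-* t ti s si (ℤ.- r D))
                               (prodOver-cong D (λ e → sym (neg-*-neg (v e) (u e))))))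
              (solve 5 (λ m1 m2 zt zs p → (m1 :* m2) :* ((zt :* zs) :* p) := p :* ((m1 :* zt) :* (m2 :* zs)))
                 refl (m₁ D) (m₂ D) (zpow t ti (ℤ.- r D)) (zpow s si (ℤ.- r D)) _)

    rhs-summand : s * si ≈ 1# → (u v : Fin n → Carrier) → ∀ A →
      zpow s si (ℤ.- r A)
        * (prodOver A (λ e → - v e)
        * (Z A r m₁ t ti (λ e → - u e)
        * Z (⊤ ─ A) (λ B → r (B ∪ A) ℤ.- r A) (λ B → m₂ (B ∪ A)) s si v))
      ≈ sumSub² A (⊤ ─ A) (chainWeight (λ e → - v e) (λ e → - u e) v F A)
    rhs-summand s-inv u v A = begin
      zsA * (pv * (Z A r m₁ t ti (λ e → - u e) * Z (⊤ ─ A) r/A m₂/A s si v))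
        ≈⟨ *-congˡ (*-congˡ (*-cong (sumList≈sumSub A g) (sumList≈sumSub (⊤ ─ A) h))) ⟩
      zsA * (pv * (sumSub A g * sumSub (⊤ ─ A) h))
        ≈⟨ *-congˡ (*-congˡ (sumSub-*-sumSub A (⊤ ─ A) g h)) ⟩
      zsA * (pv * sumSub² A (⊤ ─ A) (λ B C → g B * h C))
        ≈⟨ *-congˡ (sumSub²-*ˡ A (⊤ ─ A) pv _) ⟩
      zsA * sumSub² A (⊤ ─ A) (λ B C → pv * (g B * h C))
        ≈⟨ sumSub²-*ˡ A (⊤ ─ A) zsA _ ⟩
      sumSub² A (⊤ ─ A) (λ B C → zsA * (pv * (g B * h C)))
        ≈⟨ sumSub-cong A (λ B → sumSub-cong (⊤ ─ A) (term B)) ⟩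
      sumSub² A (⊤ ─ A) (chainWeight (λ e → - v e) (λ e → - u e) v F A) ∎
      where
      r/A : Subset n → ℤ
      r/A B = r (B ∪ A) ℤ.- r A
      m₂/A : Subset n → Carrier
      m₂/A B = m₂ (B ∪ A)
      zsA pv : Carrier
      zsA = zpow s si (ℤ.- r A)
      pv = prodOver A (λ e → - v e)
      g h : Subset n → Carrier
      g B = m₁ B * (zpow t ti (ℤ.- r B) * prodOver B (λ e → - u e))
      h C = m₂ (C ∪ A) * (zpow s si (ℤ.- (r (C ∪ A) ℤ.- r A)) * prodOver C v)
      term : ∀ B C → zsA * (pv * (g B * h C))
                     ≈ chainWeight (λ e → - v e) (λ e → - u e) v F A B C
      term B C =
        trans (solve 8 (λ za p m1 zt pu m2 zc pw →
                 za :* (p :* ((m1 :* (zt :* pu)) :* (m2 :* (zc :* pw))))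
                 := p :* (pu :* (pw :* ((m1 :* zt) :* (m2 :* (za :* zc)))))) refl
                 zsA pv (m₁ B) (zpow t ti (ℤ.- r B)) (prodOver B (λ e → - u e))
                 (m₂ (C ∪ A)) (zpow s si (ℤ.- (r (C ∪ A) ℤ.- r A))) (prodOver C v))
              (*-congˡ (*-congˡ (*-congˡ (*-congˡ (*-congˡ (zpow-split s si s-inv (r A) (r (C ∪ A))))))))

theorem3p10 : ∀ {c ℓ : Level} (R : CommutativeRing c ℓ) →
    let open CommutativeRing R
        open Tutte R
    in ∀ (n : ℕ) (r : Subset n → ℤ) (m₁ m₂ : Subset n → Carrier)
         (t tinv s sinv : Carrier) → t * tinv ≈ 1# → s * sinv ≈ 1# →
         (u v : Fin n → Carrier) →
         Z ⊤ r (λ A → m₁ A * m₂ A) (t * s) (tinv * sinv) (λ e → u e * v e)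
         ≈ sumList (map (λ A → zpow s sinv (ℤ.- r A)
               * (prodOver A (λ e → - v e)
               * (Z A r m₁ t tinv (λ e → - u e)
               * Z (⊤ ─ A) (λ B → r (B ∪ A) ℤ.- r A) (λ B → m₂ (B ∪ A)) s sinv v)))
             (subsetsOf ⊤))
-- Only s needs to be a unit: t⁻¹ occurs solely through the formal powers
-- zpow t tinv, which are never recombined.
theorem3p10 R n r m₁ m₂ t tinv s sinv _ s-inv u v = begin
    Z ⊤ r (λ A → m₁ A * m₂ A) (t * s) (tinv * sinv) (λ e → u e * v e)
      ≈⟨ lhs-collapsed u v ⟩
    sumSub ⊤ (λ D → prodOver D (λ e → - v e * - u e) * F D D)
      ≈⟨ collapse (λ e → - v e) (λ e → - u e) v (λ e → -‿inverseˡ (v e)) F ⟨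
    Chain (chainWeight (λ e → - v e) (λ e → - u e) v F)
      ≈⟨ trans (sumList≈sumSub (⊤ {n}) _) (sumSub-cong ⊤ (rhs-summand s-inv u v)) ⟨
    _ ∎
  where
  open CommutativeRing R
  open Tutte R
  open Proof R
  open Expansion n r m₁ m₂ t tinv s sinv
  open import Relation.Binary.Reasoning.Setoid setoid
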